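{- Let $n\ge 0$, $r\ge 1$ and $j\ge r-1$ be integers. Then \[ \sum_{k=j-r+1}^{n}\binom{n}{k}{n-k\brace r-1}{k\brace j-r+1}=(-1)^{j-r+1}{n\brace j}\bigl(d_{j,r-1}-r\,d_{j,r}\bigr) \] and \[ \sum_{i=0}^{r-1}(-1)^{i}\binom{r-1}{i}{n+i\brace j-(r-1-i)}_{i}=(r-1)!\,(-1)^{j}{n\brace j}\bigl(d_{j,r-1}-r\,d_{j,r}\bigr). \]
   Context: ${n\brace k}$ denotes the Stirling number of the second kind (zero if $k<0$ or $k>n$). For $s\ge0$, ${n+s\brace k+s}_s$ is the $s$-Stirling number of the second kind: the number of partitions of $\{1,\dots,n+s\}$ into $k+s$ nonempty blocks such that $1,\dots,s$ lie in distinct blocks (zero if $k<0$). $d_{k,r}$ is the number of permutations of a $k$-set with exactly $r$ fixed points ($d_{k,r}=\binom{k}{r}d_{k-r}$ for $k\ge r$, $0$ otherwise, $d_m=m!\sum_{i=0}^m(-1)^i/i!$). -}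

module Defs where

open import Data.Nat using (ℕ; zero; suc; _+_; _*_; _∸_; _/_; _≤ᵇ_; _!)
open import Data.Nat.Properties using (_!≢0)
open import Data.Nat.Combinatorics using (_C_)
open import Data.Integer as ℤ using (ℤ; +_)
open import Data.Bool using (if_then_else_)

S2 : ℕ → ℕ → ℕ
S2 zero    zero    = 1
S2 zero    (suc k) = 0
S2 (suc n) zero    = 0
S2 (suc n) (suc k) = suc k * S2 n (suc k) + S2 n k

-- sS2 s n k = {n+s brace k+s}_s, the s-Stirling number of the second kind
-- (partitions of {1..n+s} into k+s blocks with 1..s in distinct blocks),
-- given by conditioning on where the element n+s+1 goes.
sS2 : ℕ → ℕ → ℕ → ℕ
sS2 s zero    zero    = 1
sS2 s zero    (suc k) = 0
sS2 s (suc n) zero    = s * sS2 s n zero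
sS2 s (suc n) (suc k) = (suc k + s) * sS2 s n (suc k) + sS2 s n k

sgn : ℕ → ℤ
sgn zero    = ℤ.+ 1
sgn (suc i) = ℤ.- sgn i

Σ< : ℕ → (ℕ → ℤ) → ℤ
Σ< zero    f = + 0
Σ< (suc m) f = Σ< m f ℤ.+ f m

ΣFromTo : ℕ → ℕ → (ℕ → ℤ) → ℤ
ΣFromTo a b f = Σ< (suc b ∸ a) (λ i → f (a + i))

-- number of derangements d_m = m! Σ_{i=0}^m (-1)^i / i!
--                            = Σ_{i=0}^m (-1)^i (m!/i!)   (exact division)
der : ℕ → ℤ
der m = Σ< (suc m) (λ i → sgn i ℤ.* + (_/_ (m !) (i !) {{i !≢0}}))

d : ℕ → ℕ → ℤ
d k r = if r ≤ᵇ k then + (k C r) ℤ.* der (k ∸ r) else + 0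

{-# OPTIONS --safe #-}
-- Write p = r − 1, m = j − p, and (f ⊛ g)(n) = Σ_k C(n,k) f(n−k) g(k) for the binomial convolution.
-- The first sum is (S(·,p) ⊛ S(·,m))(n). The s-Stirling numbers are (s^· ⊛ S(·,m))(n), so the explicit
-- formula Σ_i (−1)^i C(p,i) i^N = (−1)^p p! S(N,p) turns the second sum into (−1)^p p! times the first.
-- The Leibniz rule (f ⊛ g)(n+1) = (f(·+1) ⊛ g)(n) + (f ⊛ g(·+1))(n) and the column recurrence
-- S(n+1,a) = a S(n,a) + S(n,a−1) give (S(·,a) ⊛ S(·,b))(n) = C(a+b,a) S(n,a+b) by induction on n.
-- On the right, the recurrence d_{m+1} = (m+1) d_m + (−1)^{m+1} together with
-- (p+1) C(j+1,p+1) = (m+1) C(j+1,p) collapses d_{j,p} − (p+1) d_{j,p+1} to (−1)^m C(j,p).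
module Submission where

open import Defs
open import Data.Nat as ℕ using (ℕ; zero; suc; _∸_; _^_; _!; _/_; _<_; _>_; _≤_; _≥_; _≤ᵇ_; s≤s)
import Data.Nat.Properties as ℕₚ
open import Data.Nat.Properties using (_!≢0)
open import Data.Nat.DivMod using (*-/-assoc; n/n≡1)
open import Data.Nat.Divisibility using (m≤n⇒m!∣n!)
open import Data.Nat.Combinatorics using (_C_; nCk+nC[k+1]≡[n+1]C[k+1]; k>n⇒nCk≡0; nCn≡1; nC1≡n)
import Data.Nat.Tactic.RingSolver as ℕ-Solver
open import Data.Integer using (ℤ; +_; -_; _+_; _*_; _-_)
open import Data.Integer.Properties
open import Data.Integer.Tactic.RingSolver using (solve-∀)
open import Algebra.Properties.CommutativeSemigroup +-commutativeSemigroup using (interchange)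
open import Data.Bool using (true; false)
open import Data.Product using (_×_; _,_)
open import Function using (_∘_)
open import Relation.Nullary using (yes; no)
open import Relation.Nullary.Reflects using (ofʸ; ofⁿ)
open import Relation.Nullary.Negation using (contradiction)
open import Relation.Binary.PropositionalEquality
open ≡-Reasoning

Σ<-cong : ∀ m {f g : ℕ → ℤ} → (∀ i → i < m → f i ≡ g i) → Σ< m f ≡ Σ< m g
Σ<-cong zero    f≗g = refl
Σ<-cong (suc m) f≗g =
  cong₂ _+_ (Σ<-cong m (λ i i<m → f≗g i (ℕₚ.m<n⇒m<1+n i<m))) (f≗g m (ℕₚ.n<1+n m))

Σ<-zero : ∀ m {f : ℕ → ℤ} → (∀ i → i < m → f i ≡ + 0) → Σ< m f ≡ + 0
Σ<-zero zero    f≗0 = refl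
Σ<-zero (suc m) f≗0 =
  cong₂ _+_ (Σ<-zero m (λ i i<m → f≗0 i (ℕₚ.m<n⇒m<1+n i<m))) (f≗0 m (ℕₚ.n<1+n m))

Σ<-distrib-+ : ∀ m (f g : ℕ → ℤ) → Σ< m (λ i → f i + g i) ≡ Σ< m f + Σ< m g
Σ<-distrib-+ zero    f g = refl
Σ<-distrib-+ (suc m) f g =
  trans (cong (_+ (f m + g m)) (Σ<-distrib-+ m f g)) (interchange (Σ< m f) (Σ< m g) (f m) (g m))

Σ<-distribˡ-* : ∀ m c (f : ℕ → ℤ) → Σ< m (λ i → c * f i) ≡ c * Σ< m f
Σ<-distribˡ-* zero    c f = sym (*-zeroʳ c)
Σ<-distribˡ-* (suc m) c f =
  trans (cong (_+ c * f m) (Σ<-distribˡ-* m c f)) (sym (*-distribˡ-+ c (Σ< m f) (f m)))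

Σ<-head : ∀ m (f : ℕ → ℤ) → Σ< (suc m) f ≡ f 0 + Σ< m (f ∘ suc)
Σ<-head zero    f = +-comm (+ 0) (f 0)
Σ<-head (suc m) f = trans (cong (_+ f (suc m)) (Σ<-head m f)) (+-assoc (f 0) _ _)

Σ<-split : ∀ m a (f : ℕ → ℤ) → Σ< (m ℕ.+ a) f ≡ Σ< m f + Σ< a (λ i → f (m ℕ.+ i))
Σ<-split m zero    f = trans (cong (λ l → Σ< l f) (ℕₚ.+-identityʳ m)) (sym (+-identityʳ _))
Σ<-split m (suc a) f = begin
  Σ< (m ℕ.+ suc a) f                               ≡⟨ cong (λ l → Σ< l f) (ℕₚ.+-suc m a) ⟩
  Σ< (m ℕ.+ a) f + f (m ℕ.+ a)                     ≡⟨ cong (_+ f (m ℕ.+ a)) (Σ<-split m a f) ⟩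
  Σ< m f + Σ< a (λ i → f (m ℕ.+ i)) + f (m ℕ.+ a)  ≡⟨ +-assoc (Σ< m f) _ _ ⟩
  Σ< m f + Σ< (suc a) (λ i → f (m ℕ.+ i))          ∎

ΣFromTo≡Σ< : ∀ a b (f : ℕ → ℤ) → (∀ k → k < a → f k ≡ + 0) → ΣFromTo a b f ≡ Σ< (suc b) f
ΣFromTo≡Σ< a b f f≗0 with a ℕ.≤? suc b
... | yes a≤1+b = begin
  Σ< (suc b ∸ a) (λ i → f (a ℕ.+ i))
    ≡⟨ +-identityˡ _ ⟨
  + 0 + Σ< (suc b ∸ a) (λ i → f (a ℕ.+ i))
    ≡⟨ cong (_+ Σ< (suc b ∸ a) (λ i → f (a ℕ.+ i))) (Σ<-zero a f≗0) ⟨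
  Σ< a f + Σ< (suc b ∸ a) (λ i → f (a ℕ.+ i))
    ≡⟨ Σ<-split a (suc b ∸ a) f ⟨
  Σ< (a ℕ.+ (suc b ∸ a)) f
    ≡⟨ cong (λ l → Σ< l f) (ℕₚ.m+[n∸m]≡n a≤1+b) ⟩
  Σ< (suc b) f ∎
... | no a≰1+b = begin
  Σ< (suc b ∸ a) (λ i → f (a ℕ.+ i))
    ≡⟨ cong (λ l → Σ< l (λ i → f (a ℕ.+ i))) (ℕₚ.m≤n⇒m∸n≡0 (ℕₚ.<⇒≤ 1+b<a)) ⟩
  + 0
    ≡⟨ Σ<-zero (suc b) (λ k k<1+b → f≗0 k (ℕₚ.<-trans k<1+b 1+b<a)) ⟨
  Σ< (suc b) f ∎
  where
  1+b<a : suc b < a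
  1+b<a = ℕₚ.≰⇒> a≰1+b

+C-pascal : ∀ n k → + (suc n C suc k) ≡ + (n C k) + + (n C suc k)
+C-pascal n k = trans (cong +_ (sym (nCk+nC[k+1]≡[n+1]C[k+1] n k))) (pos-+ (n C k) (n C suc k))

Σ<-pascal : ∀ n (h : ℕ → ℤ) →
  Σ< (suc (suc n)) (λ k → + (suc n C k) * h k) ≡
  Σ< (suc n) (λ k → + (n C k) * h k) + Σ< (suc n) (λ k → + (n C k) * h (suc k))
Σ<-pascal n h = begin
  Σ< (suc (suc n)) (λ k → + (suc n C k) * h k)
    ≡⟨ Σ<-head (suc n) _ ⟩
  + 1 * h 0 + Σ< (suc n) (λ k → + (suc n C suc k) * h (suc k))
    ≡⟨ cong (_+_ (+ 1 * h 0)) (Σ<-cong (suc n) (λ k _ →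
         trans (cong (_* h (suc k)) (+C-pascal n k)) (*-distribʳ-+ (h (suc k)) (+ (n C k)) (+ (n C suc k))))) ⟩
  + 1 * h 0 + Σ< (suc n) (λ k → + (n C k) * h (suc k) + + (n C suc k) * h (suc k))
    ≡⟨ cong (_+_ (+ 1 * h 0)) (Σ<-distrib-+ (suc n) _ _) ⟩
  + 1 * h 0 + (L + (R + + (n C suc n) * h (suc n)))
    ≡⟨ cong (λ c → + 1 * h 0 + (L + (R + + c * h (suc n)))) (k>n⇒nCk≡0 (ℕₚ.n<1+n n)) ⟩
  + 1 * h 0 + (L + (R + + 0))
    ≡⟨ regroup (+ 1 * h 0) L R ⟩
  + 1 * h 0 + R + L
    ≡⟨ cong (_+ L) (Σ<-head n (λ k → + (n C k) * h k)) ⟨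
  Σ< (suc n) (λ k → + (n C k) * h k) + L ∎
  where
  L : ℤ
  L = Σ< (suc n) (λ k → + (n C k) * h (suc k))
  R : ℤ
  R = Σ< n (λ k → + (n C suc k) * h (suc k))
  regroup : ∀ a l r → a + (l + (r + + 0)) ≡ a + r + l
  regroup = solve-∀

[k+1]*[n+1]C[k+1]≡[n+1]*nCk : ∀ n k → suc k ℕ.* (suc n C suc k) ≡ suc n ℕ.* (n C k)
[k+1]*[n+1]C[k+1]≡[n+1]*nCk n       zero    =
  trans (ℕₚ.+-identityʳ (suc n C 1)) (trans (nC1≡n (suc n)) (sym (ℕₚ.*-identityʳ (suc n))))
[k+1]*[n+1]C[k+1]≡[n+1]*nCk zero    (suc k) = ℕₚ.*-zeroʳ (suc (suc k))
[k+1]*[n+1]C[k+1]≡[n+1]*nCk (suc n) (suc k) = begin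
  suc (suc k) ℕ.* (suc (suc n) C suc (suc k))
    ≡⟨ cong (suc (suc k) ℕ.*_) (nCk+nC[k+1]≡[n+1]C[k+1] (suc n) (suc k)) ⟨
  suc (suc k) ℕ.* (X ℕ.+ Y)
    ≡⟨ split k X Y ⟩
  suc k ℕ.* X ℕ.+ X ℕ.+ suc (suc k) ℕ.* Y
    ≡⟨ cong₂ (λ u v → u ℕ.+ X ℕ.+ v) ([k+1]*[n+1]C[k+1]≡[n+1]*nCk n k)
                                      ([k+1]*[n+1]C[k+1]≡[n+1]*nCk n (suc k)) ⟩
  suc n ℕ.* (n C k) ℕ.+ X ℕ.+ suc n ℕ.* (n C suc k)
    ≡⟨ merge n (n C k) X (n C suc k) ⟩
  suc n ℕ.* (n C k ℕ.+ n C suc k) ℕ.+ X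
    ≡⟨ cong (λ c → suc n ℕ.* c ℕ.+ X) (nCk+nC[k+1]≡[n+1]C[k+1] n k) ⟩
  suc n ℕ.* X ℕ.+ X
    ≡⟨ ℕₚ.+-comm (suc n ℕ.* X) X ⟩
  suc (suc n) ℕ.* X ∎
  where
  X : ℕ
  X = suc n C suc k
  Y : ℕ
  Y = suc n C suc (suc k)
  split : ∀ k x y → suc (suc k) ℕ.* (x ℕ.+ y) ≡ suc k ℕ.* x ℕ.+ x ℕ.+ suc (suc k) ℕ.* y
  split = ℕ-Solver.solve-∀
  merge : ∀ n a x b → suc n ℕ.* a ℕ.+ x ℕ.+ suc n ℕ.* b ≡ suc n ℕ.* (a ℕ.+ b) ℕ.+ x
  merge = ℕ-Solver.solve-∀

k*[n+1]Ck+[n+1]*nCk≡[n+1]*[n+1]Ck : ∀ n k → k ℕ.* (suc n C k) ℕ.+ suc n ℕ.* (n C k) ≡ suc n ℕ.* (suc n C k)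
k*[n+1]Ck+[n+1]*nCk≡[n+1]*[n+1]Ck n zero    = refl
k*[n+1]Ck+[n+1]*nCk≡[n+1]*[n+1]Ck n (suc k) = begin
  suc k ℕ.* (suc n C suc k) ℕ.+ suc n ℕ.* (n C suc k)
    ≡⟨ cong (ℕ._+ suc n ℕ.* (n C suc k)) ([k+1]*[n+1]C[k+1]≡[n+1]*nCk n k) ⟩
  suc n ℕ.* (n C k) ℕ.+ suc n ℕ.* (n C suc k)
    ≡⟨ ℕₚ.*-distribˡ-+ (suc n) (n C k) (n C suc k) ⟨
  suc n ℕ.* (n C k ℕ.+ n C suc k)
    ≡⟨ cong (suc n ℕ.*_) (nCk+nC[k+1]≡[n+1]C[k+1] n k) ⟩
  suc n ℕ.* (suc n C suc k) ∎

[k+1]*[m+k+1]C[k+1]≡[m+1]*[m+k+1]Ck : ∀ m k →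
  suc k ℕ.* (suc (m ℕ.+ k) C suc k) ≡ suc m ℕ.* (suc (m ℕ.+ k) C k)
[k+1]*[m+k+1]C[k+1]≡[m+1]*[m+k+1]Ck m k =
  trans ([k+1]*[n+1]C[k+1]≡[n+1]*nCk (m ℕ.+ k) k)
        (ℕₚ.+-cancelˡ-≡ (k ℕ.* Z) _ _
          (trans (k*[n+1]Ck+[n+1]*nCk≡[n+1]*[n+1]Ck (m ℕ.+ k) k) (split m k Z)))
  where
  Z : ℕ
  Z = suc (m ℕ.+ k) C k
  split : ∀ m k z → suc (m ℕ.+ k) ℕ.* z ≡ k ℕ.* z ℕ.+ suc m ℕ.* z
  split = ℕ-Solver.solve-∀

+k*[n+1]Ck≡[n+1]*[n+1]Ck-[n+1]*nCk : ∀ n k → + k * + (suc n C k) ≡ + suc n * + (suc n C k) - + suc n * + (n C k)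
+k*[n+1]Ck≡[n+1]*[n+1]Ck-[n+1]*nCk n k = begin
  + k * + (suc n C k)
    ≡⟨ add-sub (+ k * + (suc n C k)) (+ suc n * + (n C k)) ⟨
  + k * + (suc n C k) + + suc n * + (n C k) - + suc n * + (n C k)
    ≡⟨ cong (_- + suc n * + (n C k)) lifted ⟩
  + suc n * + (suc n C k) - + suc n * + (n C k) ∎
  where
  add-sub : ∀ x y → x + y - y ≡ x
  add-sub = solve-∀
  lifted : + k * + (suc n C k) + + suc n * + (n C k) ≡ + suc n * + (suc n C k)
  lifted = begin
    + k * + (suc n C k) + + suc n * + (n C k)     ≡⟨ cong₂ _+_ (pos-* k (suc n C k)) (pos-* (suc n) (n C k)) ⟨
    + (k ℕ.* (suc n C k)) + + (suc n ℕ.* (n C k)) ≡⟨ pos-+ (k ℕ.* (suc n C k)) (suc n ℕ.* (n C k)) ⟨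
    + (k ℕ.* (suc n C k) ℕ.+ suc n ℕ.* (n C k))   ≡⟨ cong +_ (k*[n+1]Ck+[n+1]*nCk≡[n+1]*[n+1]Ck n k) ⟩
    + (suc n ℕ.* (suc n C k))                     ≡⟨ pos-* (suc n) (suc n C k) ⟩
    + suc n * + (suc n C k)                       ∎

sgn-+ : ∀ a b → sgn (a ℕ.+ b) ≡ sgn a * sgn b
sgn-+ zero    b = sym (*-identityˡ (sgn b))
sgn-+ (suc a) b = trans (cong -_ (sgn-+ a b)) (neg-distribˡ-* (sgn a) (sgn b))

sgn*sgn≡1 : ∀ a → sgn a * sgn a ≡ + 1
sgn*sgn≡1 zero    = refl
sgn*sgn≡1 (suc a) = trans (neg*neg (sgn a)) (sgn*sgn≡1 a)
  where
  neg*neg : ∀ x → - x * - x ≡ x * x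
  neg*neg = solve-∀

der-suc : ∀ m → der (suc m) ≡ + suc m * der m + sgn (suc m)
der-suc m = cong₂ _+_ (trans (Σ<-cong (suc m) lower-term) (Σ<-distribˡ-* (suc m) (+ suc m) _)) top-term
  where
  lower-term : ∀ i → i < suc m →
    sgn i * + (_/_ (suc m !) (i !) {{i !≢0}}) ≡ + suc m * (sgn i * + (_/_ (m !) (i !) {{i !≢0}}))
  lower-term i i<1+m = begin
    sgn i * + (_/_ (suc m ℕ.* m !) (i !) {{i !≢0}})
      ≡⟨ cong (λ q → sgn i * + q) (*-/-assoc (suc m) {{i !≢0}} (m≤n⇒m!∣n! (ℕₚ.≤-pred i<1+m))) ⟩
    sgn i * + (suc m ℕ.* _/_ (m !) (i !) {{i !≢0}})
      ≡⟨ cong (sgn i *_) (pos-* (suc m) _) ⟩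
    sgn i * (+ suc m * + (_/_ (m !) (i !) {{i !≢0}}))
      ≡⟨ *-assoc-comm (sgn i) (+ suc m) _ ⟩
    + suc m * (sgn i * + (_/_ (m !) (i !) {{i !≢0}})) ∎
    where
    *-assoc-comm : ∀ x y z → x * (y * z) ≡ y * (x * z)
    *-assoc-comm = solve-∀
  top-term : sgn (suc m) * + (_/_ (suc m !) (suc m !) {{suc m !≢0}}) ≡ sgn (suc m)
  top-term = trans (cong (λ q → sgn (suc m) * + q) (n/n≡1 (suc m !) {{suc m !≢0}})) (*-identityʳ _)

d-≤ : ∀ {k r} → r ≤ k → d k r ≡ + (k C r) * der (k ∸ r)
d-≤ {k} {r} r≤k with r ≤ᵇ k | ℕₚ.≤ᵇ-reflects-≤ r k
... | true  | _        = refl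
... | false | ofⁿ r≰k = contradiction r≤k r≰k

d-> : ∀ {k r} → k < r → d k r ≡ + 0
d-> {k} {r} k<r with r ≤ᵇ k | ℕₚ.≤ᵇ-reflects-≤ r k
... | true  | ofʸ r≤k = contradiction r≤k (ℕₚ.<⇒≱ k<r)
... | false | _        = refl

d-difference : ∀ m p → d (m ℕ.+ p) p - + suc p * d (m ℕ.+ p) (suc p) ≡ sgn m * + ((m ℕ.+ p) C p)
d-difference zero    p = begin
  d p p - + suc p * d p (suc p)
    ≡⟨ cong₂ (λ u v → u - + suc p * v) (d-≤ (ℕₚ.≤-refl {p})) (d-> (ℕₚ.n<1+n p)) ⟩
  + (p C p) * der (p ∸ p) - + suc p * + 0
    ≡⟨ cong (λ l → + (p C p) * der l - + suc p * + 0) (ℕₚ.n∸n≡0 p) ⟩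
  + (p C p) * + 1 - + suc p * + 0
    ≡⟨ simplify (+ (p C p)) (+ suc p) ⟩
  + 1 * + (p C p) ∎
  where
  simplify : ∀ x y → x * + 1 - y * + 0 ≡ + 1 * x
  simplify = solve-∀
d-difference (suc m) p = begin
  d (suc N) p - + suc p * d (suc N) (suc p)
    ≡⟨ cong₂ (λ u v → u - + suc p * v) (d-≤ (ℕₚ.m≤n+m p (suc m))) (d-≤ (s≤s (ℕₚ.m≤n+m p m))) ⟩
  + A * der (suc N ∸ p) - + suc p * (+ B * der (N ∸ p))
    ≡⟨ cong₂ (λ u v → + A * der u - + suc p * (+ B * der v))
             (ℕₚ.m+n∸n≡m (suc m) p) (ℕₚ.m+n∸n≡m m p) ⟩
  + A * der (suc m) - + suc p * (+ B * der m)
    ≡⟨ cong (λ u → + A * u - + suc p * (+ B * der m)) (der-suc m) ⟩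
  + A * (+ suc m * der m + sgn (suc m)) - + suc p * (+ B * der m)
    ≡⟨ cong (λ u → + A * (+ suc m * der m + sgn (suc m)) - u) (*-assoc (+ suc p) (+ B) (der m)) ⟨
  + A * (+ suc m * der m + sgn (suc m)) - + suc p * + B * der m
    ≡⟨ cong (λ u → + A * (+ suc m * der m + sgn (suc m)) - u * der m) absorption ⟩
  + A * (+ suc m * der m + sgn (suc m)) - + suc m * + A * der m
    ≡⟨ cancel (+ A) (+ suc m) (der m) (sgn (suc m)) ⟩
  sgn (suc m) * + A ∎
  where
  N : ℕ
  N = m ℕ.+ p
  A : ℕ
  A = suc N C p
  B : ℕ
  B = suc N C suc p
  absorption : + suc p * + B ≡ + suc m * + A
  absorption = trans (sym (pos-* (suc p) B))
    (trans (cong +_ ([k+1]*[m+k+1]C[k+1]≡[m+1]*[m+k+1]Ck m p)) (pos-* (suc m) A))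
  cancel : ∀ a μ δ s → a * (μ * δ + s) - μ * a * δ ≡ s * a
  cancel = solve-∀

infixl 7 _⊛_

-- The exponential generating function of f ⊛ g is the product of those of f and g.
_⊛_ : (ℕ → ℤ) → (ℕ → ℤ) → ℕ → ℤ
(f ⊛ g) n = Σ< (suc n) (λ k → + (n C k) * f (n ∸ k) * g k)

⊛-congˡ : ∀ {f f′} g n → (∀ x → f x ≡ f′ x) → (f ⊛ g) n ≡ (f′ ⊛ g) n
⊛-congˡ g n f≗f′ =
  Σ<-cong (suc n) (λ k _ → cong (λ y → + (n C k) * y * g k) (f≗f′ (n ∸ k)))

⊛-congʳ : ∀ {g g′} f n → (∀ x → g x ≡ g′ x) → (f ⊛ g) n ≡ (f ⊛ g′) n
⊛-congʳ f n g≗g′ = Σ<-cong (suc n) (λ k _ → cong (+ (n C k) * f (n ∸ k) *_) (g≗g′ k))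

⊛-zeroˡ : ∀ g n → ((λ _ → + 0) ⊛ g) n ≡ + 0
⊛-zeroˡ g n = Σ<-zero (suc n) (λ k _ → cong (_* g k) (*-zeroʳ (+ (n C k))))

⊛-zeroʳ : ∀ f n → (f ⊛ (λ _ → + 0)) n ≡ + 0
⊛-zeroʳ f n = Σ<-zero (suc n) (λ k _ → *-zeroʳ (+ (n C k) * f (n ∸ k)))

⊛-*ˡ : ∀ c f g n → ((λ x → c * f x) ⊛ g) n ≡ c * (f ⊛ g) n
⊛-*ˡ c f g n =
  trans (Σ<-cong (suc n) (λ k _ → pull (+ (n C k)) c (f (n ∸ k)) (g k))) (Σ<-distribˡ-* (suc n) c _)
  where
  pull : ∀ b c x y → b * (c * x) * y ≡ c * (b * x * y)
  pull = solve-∀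

⊛-*ʳ : ∀ c f g n → (f ⊛ (λ x → c * g x)) n ≡ c * (f ⊛ g) n
⊛-*ʳ c f g n =
  trans (Σ<-cong (suc n) (λ k _ → pull (+ (n C k)) c (f (n ∸ k)) (g k))) (Σ<-distribˡ-* (suc n) c _)
  where
  pull : ∀ b c x y → b * x * (c * y) ≡ c * (b * x * y)
  pull = solve-∀

⊛-+ˡ : ∀ f₁ f₂ g n → ((λ x → f₁ x + f₂ x) ⊛ g) n ≡ (f₁ ⊛ g) n + (f₂ ⊛ g) n
⊛-+ˡ f₁ f₂ g n =
  trans (Σ<-cong (suc n) (λ k _ → expand (+ (n C k)) (f₁ (n ∸ k)) (f₂ (n ∸ k)) (g k)))
        (Σ<-distrib-+ (suc n) _ _)
  where
  expand : ∀ b x₁ x₂ y → b * (x₁ + x₂) * y ≡ b * x₁ * y + b * x₂ * y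
  expand = solve-∀

⊛-+ʳ : ∀ f g₁ g₂ n → (f ⊛ (λ x → g₁ x + g₂ x)) n ≡ (f ⊛ g₁) n + (f ⊛ g₂) n
⊛-+ʳ f g₁ g₂ n =
  trans (Σ<-cong (suc n) (λ k _ → expand (+ (n C k)) (f (n ∸ k)) (g₁ k) (g₂ k)))
        (Σ<-distrib-+ (suc n) _ _)
  where
  expand : ∀ b x y₁ y₂ → b * x * (y₁ + y₂) ≡ b * x * y₁ + b * x * y₂
  expand = solve-∀

⊛-Σ<ˡ : ∀ r (h : ℕ → ℕ → ℤ) g n →
  ((λ x → Σ< r (λ i → h i x)) ⊛ g) n ≡ Σ< r (λ i → (h i ⊛ g) n)
⊛-Σ<ˡ zero    h g n = ⊛-zeroˡ g n
⊛-Σ<ˡ (suc r) h g n =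
  trans (⊛-+ˡ (λ x → Σ< r (λ i → h i x)) (h r) g n) (cong (_+ (h r ⊛ g) n) (⊛-Σ<ˡ r h g n))

⊛-leibniz : ∀ f g n → (f ⊛ g) (suc n) ≡ ((f ∘ suc) ⊛ g) n + (f ⊛ (g ∘ suc)) n
⊛-leibniz f g n = begin
  Σ< (suc (suc n)) (λ k → + (suc n C k) * f (suc n ∸ k) * g k)
    ≡⟨ Σ<-cong (suc (suc n)) (λ k _ → *-assoc (+ (suc n C k)) (f (suc n ∸ k)) (g k)) ⟩
  Σ< (suc (suc n)) (λ k → + (suc n C k) * (f (suc n ∸ k) * g k))
    ≡⟨ Σ<-pascal n (λ k → f (suc n ∸ k) * g k) ⟩
  Σ< (suc n) (λ k → + (n C k) * (f (suc n ∸ k) * g k))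
    + Σ< (suc n) (λ k → + (n C k) * (f (n ∸ k) * g (suc k)))
    ≡⟨ cong₂ _+_ (Σ<-cong (suc n) first)
                 (Σ<-cong (suc n) (λ k _ → sym (*-assoc (+ (n C k)) (f (n ∸ k)) (g (suc k))))) ⟩
  ((f ∘ suc) ⊛ g) n + (f ⊛ (g ∘ suc)) n ∎
  where
  first : ∀ k → k < suc n → + (n C k) * (f (suc n ∸ k) * g k) ≡ + (n C k) * f (suc (n ∸ k)) * g k
  first k k<1+n = trans (cong (λ l → + (n C k) * (f l * g k)) (ℕₚ.+-∸-assoc 1 (ℕₚ.≤-pred k<1+n)))
                        (sym (*-assoc (+ (n C k)) (f (suc (n ∸ k))) (g k)))

k>n⇒S2nk≡0 : ∀ {n k} → k > n → S2 n k ≡ 0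
k>n⇒S2nk≡0 {zero}  {suc k} _ = refl
k>n⇒S2nk≡0 {suc n} {suc k} (s≤s k>n)
  rewrite k>n⇒S2nk≡0 (ℕₚ.m<n⇒m<1+n k>n) | k>n⇒S2nk≡0 k>n =
  trans (ℕₚ.+-identityʳ (k ℕ.* 0)) (ℕₚ.*-zeroʳ k)

S2col : ℕ → ℕ → ℤ
S2col k n = + S2 n k

S2col-pred : ℕ → ℕ → ℤ
S2col-pred zero    n = + 0
S2col-pred (suc k) n = S2col k n

S2col-suc : ∀ k n → S2col k (suc n) ≡ + k * S2col k n + S2col-pred k n
S2col-suc zero    n = refl
S2col-suc (suc k) n =
  trans (pos-+ (suc k ℕ.* S2 n (suc k)) (S2 n k)) (cong (_+ S2col k n) (pos-* (suc k) (S2 n (suc k))))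

S2col-suc-⊛ˡ : ∀ a g n → ((S2col a ∘ suc) ⊛ g) n ≡ + a * (S2col a ⊛ g) n + (S2col-pred a ⊛ g) n
S2col-suc-⊛ˡ a g n = begin
  ((S2col a ∘ suc) ⊛ g) n
    ≡⟨ ⊛-congˡ g n (S2col-suc a) ⟩
  ((λ x → + a * S2col a x + S2col-pred a x) ⊛ g) n
    ≡⟨ ⊛-+ˡ (λ x → + a * S2col a x) (S2col-pred a) g n ⟩
  ((λ x → + a * S2col a x) ⊛ g) n + (S2col-pred a ⊛ g) n
    ≡⟨ cong (_+ (S2col-pred a ⊛ g) n) (⊛-*ˡ (+ a) (S2col a) g n) ⟩
  + a * (S2col a ⊛ g) n + (S2col-pred a ⊛ g) n ∎

S2col-suc-⊛ʳ : ∀ b f n → (f ⊛ (S2col b ∘ suc)) n ≡ + b * (f ⊛ S2col b) n + (f ⊛ S2col-pred b) n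
S2col-suc-⊛ʳ b f n = begin
  (f ⊛ (S2col b ∘ suc)) n
    ≡⟨ ⊛-congʳ f n (S2col-suc b) ⟩
  (f ⊛ (λ x → + b * S2col b x + S2col-pred b x)) n
    ≡⟨ ⊛-+ʳ f (λ x → + b * S2col b x) (S2col-pred b) n ⟩
  (f ⊛ (λ x → + b * S2col b x)) n + (f ⊛ S2col-pred b) n
    ≡⟨ cong (_+ (f ⊛ S2col-pred b) n) (⊛-*ʳ (+ b) f (S2col b) n) ⟩
  + b * (f ⊛ S2col b) n + (f ⊛ S2col-pred b) n ∎

S2col-pred-⊛ : ∀ n → (∀ a b → (S2col a ⊛ S2col b) n ≡ + ((a ℕ.+ b) C a) * S2col (a ℕ.+ b) n) →
  ∀ i j → (S2col-pred i ⊛ S2col j) n + (S2col i ⊛ S2col-pred j) n ≡ + ((i ℕ.+ j) C i) * S2col-pred (i ℕ.+ j) n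
S2col-pred-⊛ n _        zero    zero    = cong₂ _+_ (⊛-zeroˡ (S2col 0) n) (⊛-zeroʳ (S2col 0) n)
S2col-pred-⊛ n S2col-⊛ₙ zero    (suc j) = begin
  (S2col-pred 0 ⊛ S2col (suc j)) n + (S2col 0 ⊛ S2col j) n
    ≡⟨ cong (_+ (S2col 0 ⊛ S2col j) n) (⊛-zeroˡ (S2col (suc j)) n) ⟩
  + 0 + (S2col 0 ⊛ S2col j) n
    ≡⟨ +-identityˡ _ ⟩
  (S2col 0 ⊛ S2col j) n
    ≡⟨ S2col-⊛ₙ 0 j ⟩
  + 1 * S2col j n ∎
S2col-pred-⊛ n S2col-⊛ₙ (suc i) zero    = begin
  (S2col i ⊛ S2col 0) n + (S2col (suc i) ⊛ S2col-pred 0) n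
    ≡⟨ cong (_+_ ((S2col i ⊛ S2col 0) n)) (⊛-zeroʳ (S2col (suc i)) n) ⟩
  (S2col i ⊛ S2col 0) n + + 0
    ≡⟨ +-identityʳ _ ⟩
  (S2col i ⊛ S2col 0) n
    ≡⟨ S2col-⊛ₙ i 0 ⟩
  + ((i ℕ.+ 0) C i) * S2col (i ℕ.+ 0) n
    ≡⟨ cong (λ c → + c * S2col (i ℕ.+ 0) n) diagonal ⟩
  + (suc (i ℕ.+ 0) C suc i) * S2col (i ℕ.+ 0) n ∎
  where
  diagonal : (i ℕ.+ 0) C i ≡ suc (i ℕ.+ 0) C suc i
  diagonal rewrite ℕₚ.+-identityʳ i = trans (nCn≡1 i) (sym (nCn≡1 (suc i)))
S2col-pred-⊛ n S2col-⊛ₙ (suc i) (suc j) = begin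
  (S2col i ⊛ S2col (suc j)) n + (S2col (suc i) ⊛ S2col j) n
    ≡⟨ cong₂ _+_ (S2col-⊛ₙ i (suc j)) (S2col-⊛ₙ (suc i) j) ⟩
  + ((i ℕ.+ suc j) C i) * S2col (i ℕ.+ suc j) n + + (suc (i ℕ.+ j) C suc i) * S2col (suc (i ℕ.+ j)) n
    ≡⟨ cong (λ l → + (l C i) * S2col l n + + (suc (i ℕ.+ j) C suc i) * S2col (suc (i ℕ.+ j)) n)
            (ℕₚ.+-suc i j) ⟩
  + (suc (i ℕ.+ j) C i) * S2col (suc (i ℕ.+ j)) n + + (suc (i ℕ.+ j) C suc i) * S2col (suc (i ℕ.+ j)) n
    ≡⟨ *-distribʳ-+ (S2col (suc (i ℕ.+ j)) n) (+ (suc (i ℕ.+ j) C i)) (+ (suc (i ℕ.+ j) C suc i)) ⟨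
  (+ (suc (i ℕ.+ j) C i) + + (suc (i ℕ.+ j) C suc i)) * S2col (suc (i ℕ.+ j)) n
    ≡⟨ cong (_* S2col (suc (i ℕ.+ j)) n) (+C-pascal (suc (i ℕ.+ j)) i) ⟨
  + (suc (suc (i ℕ.+ j)) C suc i) * S2col (suc (i ℕ.+ j)) n
    ≡⟨ cong (λ l → + (suc l C suc i) * S2col l n) (ℕₚ.+-suc i j) ⟨
  + (suc (i ℕ.+ suc j) C suc i) * S2col (i ℕ.+ suc j) n ∎

S2col-⊛ : ∀ a b n → (S2col a ⊛ S2col b) n ≡ + ((a ℕ.+ b) C a) * S2col (a ℕ.+ b) n
S2col-⊛ zero    zero    zero    = refl
S2col-⊛ zero    (suc b) zero    = refl
S2col-⊛ (suc a) b       zero    = sym (*-zeroʳ (+ ((suc a ℕ.+ b) C suc a)))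
S2col-⊛ a       b       (suc n) = begin
  (S2col a ⊛ S2col b) (suc n)
    ≡⟨ ⊛-leibniz (S2col a) (S2col b) n ⟩
  ((S2col a ∘ suc) ⊛ S2col b) n + (S2col a ⊛ (S2col b ∘ suc)) n
    ≡⟨ cong₂ _+_ (S2col-suc-⊛ˡ a (S2col b) n) (S2col-suc-⊛ʳ b (S2col a) n) ⟩
  (+ a * X + (S2col-pred a ⊛ S2col b) n) + (+ b * X + (S2col a ⊛ S2col-pred b) n)
    ≡⟨ collect (+ a) (+ b) X _ _ ⟩
  (+ a + + b) * X + P
    ≡⟨ cong₂ (λ c y → c * y + P) (sym (pos-+ a b)) (S2col-⊛ a b n) ⟩
  + (a ℕ.+ b) * (K * S2col (a ℕ.+ b) n) + P
    ≡⟨ cong (_+_ (+ (a ℕ.+ b) * (K * S2col (a ℕ.+ b) n))) (S2col-pred-⊛ n (λ i j → S2col-⊛ i j n) a b) ⟩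
  + (a ℕ.+ b) * (K * S2col (a ℕ.+ b) n) + K * S2col-pred (a ℕ.+ b) n
    ≡⟨ factor (+ (a ℕ.+ b)) K (S2col (a ℕ.+ b) n) (S2col-pred (a ℕ.+ b) n) ⟩
  K * (+ (a ℕ.+ b) * S2col (a ℕ.+ b) n + S2col-pred (a ℕ.+ b) n)
    ≡⟨ cong (K *_) (S2col-suc (a ℕ.+ b) n) ⟨
  K * S2col (a ℕ.+ b) (suc n) ∎
  where
  X : ℤ
  X = (S2col a ⊛ S2col b) n
  K : ℤ
  K = + ((a ℕ.+ b) C a)
  P : ℤ
  P = (S2col-pred a ⊛ S2col b) n + (S2col a ⊛ S2col-pred b) n
  collect : ∀ α β x y z → (α * x + y) + (β * x + z) ≡ (α + β) * x + (y + z)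
  collect = solve-∀
  factor : ∀ α κ s t → α * (κ * s) + κ * t ≡ κ * (α * s + t)
  factor = solve-∀

powers : ℕ → ℕ → ℤ
powers s x = + (s ^ x)

powers⊛S2col-suc : ∀ s m n →
  (powers s ⊛ S2col m) (suc n)
    ≡ + s * (powers s ⊛ S2col m) n + (+ m * (powers s ⊛ S2col m) n + (powers s ⊛ S2col-pred m) n)
powers⊛S2col-suc s m n = begin
  (powers s ⊛ S2col m) (suc n)
    ≡⟨ ⊛-leibniz (powers s) (S2col m) n ⟩
  ((powers s ∘ suc) ⊛ S2col m) n + (powers s ⊛ (S2col m ∘ suc)) n
    ≡⟨ cong (_+ (powers s ⊛ (S2col m ∘ suc)) n) (⊛-congˡ (S2col m) n (λ x → pos-* s (s ^ x))) ⟩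
  ((λ x → + s * powers s x) ⊛ S2col m) n + (powers s ⊛ (S2col m ∘ suc)) n
    ≡⟨ cong₂ _+_ (⊛-*ˡ (+ s) (powers s) (S2col m) n) (S2col-suc-⊛ʳ m (powers s) n) ⟩
  + s * (powers s ⊛ S2col m) n + (+ m * (powers s ⊛ S2col m) n + (powers s ⊛ S2col-pred m) n) ∎

sS2≡powers⊛S2col : ∀ s n m → + sS2 s n m ≡ (powers s ⊛ S2col m) n
sS2≡powers⊛S2col s zero    zero    = refl
sS2≡powers⊛S2col s zero    (suc m) = refl
sS2≡powers⊛S2col s (suc n) zero    = begin
  + (s ℕ.* sS2 s n 0)
    ≡⟨ pos-* s (sS2 s n 0) ⟩
  + s * + sS2 s n 0
    ≡⟨ cong (+ s *_) (sS2≡powers⊛S2col s n 0) ⟩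
  + s * (powers s ⊛ S2col 0) n
    ≡⟨ +-identityʳ _ ⟨
  + s * (powers s ⊛ S2col 0) n + + 0
    ≡⟨ cong (λ z → + s * (powers s ⊛ S2col 0) n + (+ 0 * (powers s ⊛ S2col 0) n + z))
            (⊛-zeroʳ (powers s) n) ⟨
  + s * (powers s ⊛ S2col 0) n + (+ 0 * (powers s ⊛ S2col 0) n + (powers s ⊛ S2col-pred 0) n)
    ≡⟨ powers⊛S2col-suc s 0 n ⟨
  (powers s ⊛ S2col 0) (suc n) ∎
sS2≡powers⊛S2col s (suc n) (suc m) = begin
  + ((suc m ℕ.+ s) ℕ.* sS2 s n (suc m) ℕ.+ sS2 s n m)
    ≡⟨ trans (pos-+ _ (sS2 s n m)) (cong (_+ + sS2 s n m) (pos-* (suc m ℕ.+ s) (sS2 s n (suc m)))) ⟩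
  + (suc m ℕ.+ s) * + sS2 s n (suc m) + + sS2 s n m
    ≡⟨ cong (λ c → c * + sS2 s n (suc m) + + sS2 s n m) (pos-+ (suc m) s) ⟩
  (+ suc m + + s) * + sS2 s n (suc m) + + sS2 s n m
    ≡⟨ cong₂ (λ x y → (+ suc m + + s) * x + y) (sS2≡powers⊛S2col s n (suc m)) (sS2≡powers⊛S2col s n m) ⟩
  (+ suc m + + s) * (powers s ⊛ S2col (suc m)) n + (powers s ⊛ S2col m) n
    ≡⟨ regroup (+ suc m) (+ s) _ _ ⟩
  + s * (powers s ⊛ S2col (suc m)) n + (+ suc m * (powers s ⊛ S2col (suc m)) n + (powers s ⊛ S2col m) n)
    ≡⟨ powers⊛S2col-suc s (suc m) n ⟨
  (powers s ⊛ S2col (suc m)) (suc n) ∎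
  where
  regroup : ∀ μ σ x y → (μ + σ) * x + y ≡ σ * x + (μ * x + y)
  regroup = solve-∀

alternating-Σ-C≡0 : ∀ q → Σ< (suc (suc q)) (λ i → + (suc q C i) * sgn i) ≡ + 0
alternating-Σ-C≡0 q = begin
  Σ< (suc (suc q)) (λ i → + (suc q C i) * sgn i)
    ≡⟨ Σ<-pascal q sgn ⟩
  Σ< (suc q) (λ i → + (q C i) * sgn i) + Σ< (suc q) (λ i → + (q C i) * - sgn i)
    ≡⟨ Σ<-distrib-+ (suc q) (λ i → + (q C i) * sgn i) (λ i → + (q C i) * - sgn i) ⟨
  Σ< (suc q) (λ i → + (q C i) * sgn i + + (q C i) * - sgn i)
    ≡⟨ Σ<-zero (suc q) (λ i _ → cancel (+ (q C i)) (sgn i)) ⟩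
  + 0 ∎
  where
  cancel : ∀ c x → c * x + c * - x ≡ + 0
  cancel = solve-∀

sgn-C-powers-suc : ∀ q N i →
  sgn i * + (suc q C i) * powers i (suc N)
    ≡ + suc q * (sgn i * + (suc q C i) * powers i N) + - + suc q * (sgn i * + (q C i) * powers i N)
sgn-C-powers-suc q N i = begin
  sgn i * + (suc q C i) * + (i ℕ.* i ^ N)
    ≡⟨ cong (sgn i * + (suc q C i) *_) (pos-* i (i ^ N)) ⟩
  sgn i * + (suc q C i) * (+ i * powers i N)
    ≡⟨ reorder (sgn i) (+ (suc q C i)) (+ i) (powers i N) ⟩
  sgn i * powers i N * (+ i * + (suc q C i))
    ≡⟨ cong (sgn i * powers i N *_) (+k*[n+1]Ck≡[n+1]*[n+1]Ck-[n+1]*nCk q i) ⟩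
  sgn i * powers i N * (+ suc q * + (suc q C i) - + suc q * + (q C i))
    ≡⟨ expand (sgn i) (powers i N) (+ suc q) (+ (suc q C i)) (+ (q C i)) ⟩
  + suc q * (sgn i * + (suc q C i) * powers i N) + - + suc q * (sgn i * + (q C i) * powers i N) ∎
  where
  reorder : ∀ σ c ι x → σ * c * (ι * x) ≡ σ * x * (ι * c)
  reorder = solve-∀
  expand : ∀ σ x κ c c′ → σ * x * (κ * c - κ * c′) ≡ κ * (σ * c * x) + - κ * (σ * c′ * x)
  expand = solve-∀

S2-explicit : ∀ N p → Σ< (suc p) (λ i → sgn i * + (p C i) * powers i N) ≡ sgn p * + (p !) * S2col p N
S2-explicit zero    zero    = refl
S2-explicit zero    (suc q) = begin
  Σ< (suc (suc q)) (λ i → sgn i * + (suc q C i) * + 1)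
    ≡⟨ Σ<-cong (suc (suc q)) (λ i _ → reorder (sgn i) (+ (suc q C i))) ⟩
  Σ< (suc (suc q)) (λ i → + (suc q C i) * sgn i)
    ≡⟨ alternating-Σ-C≡0 q ⟩
  + 0
    ≡⟨ *-zeroʳ (sgn (suc q) * + (suc q !)) ⟨
  sgn (suc q) * + (suc q !) * + 0 ∎
  where
  reorder : ∀ x c → x * c * + 1 ≡ c * x
  reorder = solve-∀
S2-explicit (suc N) zero    = refl
S2-explicit (suc N) (suc q) = begin
  Σ< (suc (suc q)) (λ i → sgn i * + (suc q C i) * powers i (suc N))
    ≡⟨ Σ<-cong (suc (suc q)) (λ i _ → sgn-C-powers-suc q N i) ⟩
  Σ< (suc (suc q)) (λ i → Q * E (suc q) i + - Q * E q i)
    ≡⟨ Σ<-distrib-+ (suc (suc q)) (λ i → Q * E (suc q) i) (λ i → - Q * E q i) ⟩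
  Σ< (suc (suc q)) (λ i → Q * E (suc q) i) + Σ< (suc (suc q)) (λ i → - Q * E q i)
    ≡⟨ cong₂ _+_ (Σ<-distribˡ-* (suc (suc q)) Q (E (suc q))) (Σ<-distribˡ-* (suc (suc q)) (- Q) (E q)) ⟩
  Q * Σ< (suc (suc q)) (E (suc q)) + - Q * (Σ< (suc q) (E q) + E q (suc q))
    ≡⟨ cong (λ z → Q * Σ< (suc (suc q)) (E (suc q)) + - Q * (Σ< (suc q) (E q) + z)) top-vanishes ⟩
  Q * Σ< (suc (suc q)) (E (suc q)) + - Q * (Σ< (suc q) (E q) + + 0)
    ≡⟨ cong₂ (λ u v → Q * u + - Q * v) (S2-explicit N (suc q)) (trans (+-identityʳ _) (S2-explicit N q)) ⟩
  Q * (sgn (suc q) * + (suc q ℕ.* q !) * S2col (suc q) N) + - Q * (sgn q * + (q !) * S2col q N)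
    ≡⟨ cong (λ f → Q * (sgn (suc q) * f * S2col (suc q) N) + - Q * (sgn q * + (q !) * S2col q N))
            (pos-* (suc q) (q !)) ⟩
  Q * (- sgn q * (Q * + (q !)) * S2col (suc q) N) + - Q * (sgn q * + (q !) * S2col q N)
    ≡⟨ collect Q (+ (q !)) (S2col (suc q) N) (S2col q N) (sgn q) ⟩
  - sgn q * (Q * + (q !)) * (Q * S2col (suc q) N + S2col q N)
    ≡⟨ cong₂ (λ f t → - sgn q * f * t) (pos-* (suc q) (q !)) (S2col-suc (suc q) N) ⟨
  sgn (suc q) * + (suc q !) * S2col (suc q) (suc N) ∎
  where
  Q : ℤ
  Q = + suc q
  E : ℕ → ℕ → ℤ
  E p i = sgn i * + (p C i) * powers i N
  top-vanishes : E q (suc q) ≡ + 0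
  top-vanishes = trans (cong (λ c → sgn (suc q) * + c * powers (suc q) N) (k>n⇒nCk≡0 (ℕₚ.n<1+n q)))
                       (cong (_* powers (suc q) N) (*-zeroʳ (sgn (suc q))))
  collect : ∀ κ f a b g → κ * (- g * (κ * f) * a) + - κ * (g * f * b) ≡ - g * (κ * f) * (κ * a + b)
  collect = solve-∀

S2col⊛S2col≡d-difference : ∀ p m n →
  (S2col p ⊛ S2col m) n ≡ sgn m * + S2 n (m ℕ.+ p) * (d (m ℕ.+ p) p - + suc p * d (m ℕ.+ p) (suc p))
S2col⊛S2col≡d-difference p m n = begin
  (S2col p ⊛ S2col m) n
    ≡⟨ S2col-⊛ p m n ⟩
  + ((p ℕ.+ m) C p) * S2col (p ℕ.+ m) n
    ≡⟨ cong (λ j → + (j C p) * S2col j n) (ℕₚ.+-comm p m) ⟩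
  K * S
    ≡⟨ *-identityˡ (K * S) ⟨
  + 1 * (K * S)
    ≡⟨ cong (_* (K * S)) (sgn*sgn≡1 m) ⟨
  sgn m * sgn m * (K * S)
    ≡⟨ reorder (sgn m) K S ⟩
  sgn m * S * (sgn m * K)
    ≡⟨ cong (sgn m * S *_) (d-difference m p) ⟨
  sgn m * S * (d (m ℕ.+ p) p - + suc p * d (m ℕ.+ p) (suc p)) ∎
  where
  K : ℤ
  K = + ((m ℕ.+ p) C p)
  S : ℤ
  S = S2col (m ℕ.+ p) n
  reorder : ∀ σ κ s → σ * σ * (κ * s) ≡ σ * s * (σ * κ)
  reorder = solve-∀

ΣFromTo-C-S2-S2 : ∀ n p m {j} → m ℕ.+ p ≡ j →
  ΣFromTo m n (λ k → + (n C k) * + S2 (n ∸ k) p * + S2 k m) ≡ sgn m * + S2 n j * (d j p - + suc p * d j (suc p))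
ΣFromTo-C-S2-S2 n p m refl = trans (ΣFromTo≡Σ< m n _ below-m) (S2col⊛S2col≡d-difference p m n)
  where
  below-m : ∀ k → k < m → + (n C k) * + S2 (n ∸ k) p * + S2 k m ≡ + 0
  below-m k k<m = trans (cong (λ s → + (n C k) * + S2 (n ∸ k) p * + s) (k>n⇒S2nk≡0 k<m))
                        (*-zeroʳ (+ (n C k) * + S2 (n ∸ k) p))

Σ-sgn-C-sS2 : ∀ n p m {j} → m ℕ.+ p ≡ j →
  Σ< (suc p) (λ i → sgn i * + (p C i) * + sS2 i n m) ≡ + (p !) * sgn j * + S2 n j * (d j p - + suc p * d j (suc p))
Σ-sgn-C-sS2 n p m refl = begin
  Σ< (suc p) (λ i → sgn i * + (p C i) * + sS2 i n m)
    ≡⟨ Σ<-cong (suc p) (λ i _ → cong (sgn i * + (p C i) *_) (sS2≡powers⊛S2col i n m)) ⟩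
  Σ< (suc p) (λ i → sgn i * + (p C i) * (powers i ⊛ S2col m) n)
    ≡⟨ Σ<-cong (suc p) (λ i _ → ⊛-*ˡ (sgn i * + (p C i)) (powers i) (S2col m) n) ⟨
  Σ< (suc p) (λ i → ((λ x → sgn i * + (p C i) * powers i x) ⊛ S2col m) n)
    ≡⟨ ⊛-Σ<ˡ (suc p) (λ i x → sgn i * + (p C i) * powers i x) (S2col m) n ⟨
  ((λ x → Σ< (suc p) (λ i → sgn i * + (p C i) * powers i x)) ⊛ S2col m) n
    ≡⟨ ⊛-congˡ (S2col m) n (λ x → S2-explicit x p) ⟩
  ((λ x → sgn p * + (p !) * S2col p x) ⊛ S2col m) n
    ≡⟨ ⊛-*ˡ (sgn p * + (p !)) (S2col p) (S2col m) n ⟩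
  sgn p * + (p !) * (S2col p ⊛ S2col m) n
    ≡⟨ cong (sgn p * + (p !) *_) (S2col⊛S2col≡d-difference p m n) ⟩
  sgn p * + (p !) * (sgn m * S * D)
    ≡⟨ reorder (sgn p) (+ (p !)) (sgn m) S D ⟩
  + (p !) * (sgn m * sgn p) * S * D
    ≡⟨ cong (λ σ → + (p !) * σ * S * D) (sgn-+ m p) ⟨
  + (p !) * sgn (m ℕ.+ p) * S * D ∎
  where
  S : ℤ
  S = + S2 n (m ℕ.+ p)
  D : ℤ
  D = d (m ℕ.+ p) p - + suc p * d (m ℕ.+ p) (suc p)
  reorder : ∀ σ f τ s δ → σ * f * (τ * s * δ) ≡ f * (τ * σ) * s * δ
  reorder = solve-∀

mainTheorem11 : (n r j : ℕ) → r ≥ 1 → j ≥ r ∸ 1 →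
    (ΣFromTo (j ∸ (r ∸ 1)) n
       (λ k → + (n C k) * + S2 (n ∸ k) (r ∸ 1) * + S2 k (j ∸ (r ∸ 1)))
      ≡ sgn (j ∸ (r ∸ 1)) * + S2 n j * (d j (r ∸ 1) - + r * d j r))
    ×
    (Σ< r (λ i → sgn i * + ((r ∸ 1) C i) * + sS2 i n (j ∸ (r ∸ 1)))
      ≡ + ((r ∸ 1) !) * sgn j * + S2 n j * (d j (r ∸ 1) - + r * d j r))
mainTheorem11 n zero    j ()  _
mainTheorem11 n (suc p) j _   p≤j = ΣFromTo-C-S2-S2 n p (j ∸ p) m+p≡j , Σ-sgn-C-sS2 n p (j ∸ p) m+p≡j
  where
  m+p≡j : j ∸ p ℕ.+ p ≡ j
  m+p≡j = ℕₚ.m∸n+n≡m p≤j
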